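{- For all integers $m\ge 2$ and $k\ge 1$, $\textup{aw}(P_m\square C_{2k+1},3)=3$.
   Context: All graphs are finite, simple and undirected; $\textup{d}(u,v)$ denotes shortest-path distance. $P_m$ is the path on $m$ vertices and $C_n$ the cycle on $n$ vertices. The Cartesian product $G\square H$ has vertex set $V(G)\times V(H)$, with $(x,y)$ adjacent to $(x',y')$ iff either $x=x'$ and $yy'\in E(H)$, or $y=y'$ and $xx'\in E(G)$. A 3-term arithmetic progression (3-AP) is a set of vertices $\{v_1,v_2,v_3\}$ (listed in some order) with $\textup{d}(v_1,v_2)=\textup{d}(v_2,v_3)$. An exact $r$-coloring of a graph $G$ is a surjective map $c:V(G)\to\{1,\dots,r\}$; a set is rainbow under $c$ if its vertices receive pairwise distinct colors. $\textup{aw}(G,3)$ is the least positive integer $r$ such that every exact $r$-coloring of $G$ contains a rainbow 3-AP; if no coloring yields a rainbow 3-AP, then $\textup{aw}(G,3)=|V(G)|+1$. -}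

module Defs where

open import Data.Nat using (ℕ; zero; suc; _+_; _*_; _≤_; _<_)
open import Data.Fin using (Fin; toℕ)
open import Data.Product using (_×_; Σ; ∃; _,_)
open import Data.Sum using (_⊎_)
open import Relation.Nullary using (¬_)
open import Relation.Binary.PropositionalEquality using (_≡_; _≢_)

record Graph : Set₁ where
  field
    V   : Set
    Adj : V → V → Set
open Graph public

P : ℕ → Graph
P m = record { V = Fin m ; Adj = λ i i' → (suc (toℕ i) ≡ toℕ i') ⊎ (suc (toℕ i') ≡ toℕ i) }

-- Cycle C_n on vertices 0..n-1 (Fin n), j ~ j' iff j' ≡ j+1 (mod n) or j ≡ j'+1 (mod n).
-- (Used only for n ≥ 3, where this is the simple cycle C_n.)
C : (n : ℕ) → Graph
C n = record { V = Fin n ; Adj = λ j j' → Next j j' ⊎ Next j' j }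
  where
  Next : Fin n → Fin n → Set
  Next j j' = (suc (toℕ j) ≡ toℕ j') ⊎ ((suc (toℕ j) ≡ n) × (toℕ j' ≡ 0))

_□_ : Graph → Graph → Graph
G □ H = record
  { V   = V G × V H
  ; Adj = λ { (x , y) (x' , y') → ((x ≡ x') × Adj H y y') ⊎ ((y ≡ y') × Adj G x x') } }

data Walk (G : Graph) : V G → V G → ℕ → Set where
  here : ∀ {u} → Walk G u u 0
  step : ∀ {u w v n} → Adj G u w → Walk G w v n → Walk G u v (suc n)

Dist : (G : Graph) → V G → V G → ℕ → Set
Dist G u v d = Walk G u v d × (∀ d' → Walk G u v d' → d ≤ d')

-- Exact r-coloring: surjective map V → {1..r} (represented as Fin r).
Surj : {A : Set} {r : ℕ} → (A → Fin r) → Set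
Surj {A} {r} c = ∀ (y : Fin r) → ∃ λ (x : A) → c x ≡ y

HasRainbow3AP : (G : Graph) {r : ℕ} → (V G → Fin r) → Set
HasRainbow3AP G c =
  Σ (V G) λ v₁ → Σ (V G) λ v₂ → Σ (V G) λ v₃ →
    (c v₁ ≢ c v₂) × (c v₂ ≢ c v₃) × (c v₁ ≢ c v₃) ×
    (Σ ℕ λ d → Dist G v₁ v₂ d × Dist G v₂ v₃ d)

AllRainbow : Graph → ℕ → Set
AllRainbow G r = ∀ (c : V G → Fin r) → Surj c → HasRainbow3AP G c

AwIs : Graph → ℕ → Set
AwIs G r = (1 ≤ r) × AllRainbow G r × (∀ s → 1 ≤ s → s < r → ¬ AllRainbow G s)

-- In P m □ C (2k+1) the distance from (a , x) to (b , x + t) is |a - b| + t whenever t ≤ k: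
-- a walk of that length exists, and |a - b| plus the cyclic distance of the columns is
-- 1-Lipschitz along edges. Given an exact 3-colouring, take a shortest window of consecutive
-- rows containing all three colours. If it has at least three rows, some colour X occurs only
-- in its first row, some Y only in its last, and the rows between carry the third colour;
-- between an X-vertex and a Y-vertex there is an equidistant vertex in those rows, reached
-- around the far side of the cycle when the parities do not match (this is where oddness of
-- the cycle is used). Otherwise two adjacent rows contain all colours, and the same
-- minimality argument is applied to windows of consecutive columns of this band: a window of
-- two columns is a 4-cycle, which always contains a rainbow path of length two, and wider
-- windows are settled by a case analysis on parity and on whether the window is longer than
-- half the cycle. Two colours never give a rainbow triple, so aw = 3.

module Submission where

open import Defs
open import Data.Nat
  using (ℕ; zero; suc; _+_; _*_; _∸_; _≤_; _<_; _⊓_; ∣_-_∣; z≤n; s≤s; z<s; NonZero; _<?_; _≤?_)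
open import Data.Nat.Properties hiding (_≟_)
open import Data.Nat.DivMod
  using (_%_; _/_; _mod_; m%n<n; m<n⇒m%n≡m; m≡m%n+[m/n]*n; [m+kn]%n≡m%n; [m+n]%n≡m%n; m%n%n≡m%n;
         n%n≡0; m≤n⇒[n∸m]%m≡n%m)
open import Data.Fin using (Fin; zero; suc; toℕ; _≟_)
open import Data.Fin.Properties using (toℕ-fromℕ<; toℕ-injective; toℕ<n; all?; ¬∀⟶∃¬)
open import Data.Product using (_×_; ∃; ∃₂; _,_; proj₁; proj₂; swap)
open import Data.Sum using (_⊎_; inj₁; inj₂)
import Data.Sum as Sum
open import Data.Empty using (⊥; ⊥-elim)
open import Relation.Nullary using (¬_; Dec; yes; no)
open import Relation.Nullary.Decidable using (map′; _×-dec_; _⊎-dec_)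
open import Relation.Unary using (Decidable)
open import Relation.Binary.Definitions using (Symmetric)
open import Relation.Binary.PropositionalEquality
  using (_≡_; _≢_; refl; sym; trans; cong; cong₂; subst; subst₂; ≢-sym; module ≡-Reasoning)
open import Algebra.Properties.CommutativeSemigroup +-commutativeSemigroup using (xy∙z≈xz∙y)

module _ {G : Graph} where

  _++ʷ_ : ∀ {u w z a b} → Walk G u w a → Walk G w z b → Walk G u z (a + b)
  here     ++ʷ q = q
  step e p ++ʷ q = step e (p ++ʷ q)

  reverseʷ : Symmetric (Adj G) → ∀ {u w l} → Walk G u w l → Walk G w u l
  reverseʷ sym-adj here = here
  reverseʷ sym-adj {l = suc l} (step e p) =
    subst (Walk G _ _) (+-comm l 1) (reverseʷ sym-adj p ++ʷ step (sym-adj e) here)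

  Dist-sym : Symmetric (Adj G) → ∀ {u w d} → Dist G u w d → Dist G w u d
  Dist-sym sym-adj (p , shortest) = reverseʷ sym-adj p , λ d' q → shortest d' (reverseʷ sym-adj q)

Lipschitz : (G : Graph) → (V G → V G → ℕ) → Set
Lipschitz G φ = ∀ {u w} z → Adj G u w → φ u z ≤ suc (φ w z)

module _ {G : Graph} {φ : V G → V G → ℕ} (φ-lip : Lipschitz G φ) (φ-refl : ∀ u → φ u u ≡ 0) where

  Lipschitz⇒≤length : ∀ {u w l} → Walk G u w l → φ u w ≤ l
  Lipschitz⇒≤length {u} here = ≤-reflexive (φ-refl u)
  Lipschitz⇒≤length {w = w} (step e p) = ≤-trans (φ-lip w e) (s≤s (Lipschitz⇒≤length p))

  Lipschitz⇒Dist : ∀ {u w d} → Walk G u w d → d ≤ φ u w → Dist G u w d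
  Lipschitz⇒Dist p d≤φ = p , λ d' q → ≤-trans d≤φ (Lipschitz⇒≤length q)

module _ {G H : Graph} where

  □-symmetric : Symmetric (Adj G) → Symmetric (Adj H) → Symmetric (Adj (G □ H))
  □-symmetric symG symH (inj₁ (refl , e)) = inj₁ (refl , symH e)
  □-symmetric symG symH (inj₂ (refl , e)) = inj₂ (refl , symG e)

  □-Lipschitz : ∀ {φ ψ} → Lipschitz G φ → Lipschitz H ψ →
                Lipschitz (G □ H) (λ u w → φ (proj₁ u) (proj₁ w) + ψ (proj₂ u) (proj₂ w))
  □-Lipschitz {φ} φ-lip ψ-lip (x , y) (inj₁ (refl , e)) =
    ≤-trans (+-monoʳ-≤ (φ _ x) (ψ-lip y e)) (≤-reflexive (+-suc _ _))
  □-Lipschitz {ψ = ψ} φ-lip ψ-lip (x , y) (inj₂ (refl , e)) = +-monoˡ-≤ (ψ _ y) (φ-lip x e)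

  □-walkˡ : ∀ {x x' y l} → Walk G x x' l → Walk (G □ H) (x , y) (x' , y) l
  □-walkˡ here       = here
  □-walkˡ (step e p) = step (inj₂ (refl , e)) (□-walkˡ p)

  □-walkʳ : ∀ {x y y' l} → Walk H y y' l → Walk (G □ H) (x , y) (x , y') l
  □-walkʳ here       = here
  □-walkʳ (step e p) = step (inj₁ (refl , e)) (□-walkʳ p)

∣a-1+a∣≡1 : ∀ a → ∣ a - suc a ∣ ≡ 1
∣a-1+a∣≡1 a = trans (cong (∣ a -_∣) (+-comm 1 a)) (∣m-m+n∣≡n a 1)

∣-∣-step : ∀ {a b} c → suc a ≡ b ⊎ suc b ≡ a → ∣ a - c ∣ ≤ suc ∣ b - c ∣
∣-∣-step {a} {b} c adj =
  ≤-trans (∣-∣-triangle a b c) (+-monoˡ-≤ ∣ b - c ∣ (≤-reflexive (∣a-b∣≡1 adj)))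
  where
  ∣a-b∣≡1 : suc a ≡ b ⊎ suc b ≡ a → ∣ a - b ∣ ≡ 1
  ∣a-b∣≡1 (inj₁ refl) = ∣a-1+a∣≡1 a
  ∣a-b∣≡1 (inj₂ refl) = trans (∣-∣-comm (suc b) b) (∣a-1+a∣≡1 b)

[m+o]%n≡[m%n+o]%n : ∀ x t n .{{_ : NonZero n}} → (x + t) % n ≡ (x % n + t) % n
[m+o]%n≡[m%n+o]%n x t n = begin
  (x + t) % n                       ≡⟨ cong (λ l → (l + t) % n) (m≡m%n+[m/n]*n x n) ⟩
  (x % n + x / n * n + t) % n       ≡⟨ cong (_% n) (xy∙z≈xz∙y (x % n) (x / n * n) t) ⟩
  (x % n + t + x / n * n) % n       ≡⟨ [m+kn]%n≡m%n (x % n + t) (x / n) n ⟩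
  (x % n + t) % n                   ∎
  where open ≡-Reasoning

[1+m]%n≡[1+m%n]%n : ∀ x n .{{_ : NonZero n}} → suc x % n ≡ suc (x % n) % n
[1+m]%n≡[1+m%n]%n x n = begin
  suc x % n                       ≡⟨ cong (λ z → suc z % n) (m≡m%n+[m/n]*n x n) ⟩
  (suc (x % n) + x / n * n) % n   ≡⟨ [m+kn]%n≡m%n (suc (x % n)) (x / n) n ⟩
  suc (x % n) % n                 ∎
  where open ≡-Reasoning

module _ {n : ℕ} {{_ : NonZero n}} where

  toℕ-mod : ∀ x → toℕ (x mod n) ≡ x % n
  toℕ-mod x = toℕ-fromℕ< (m%n<n x n)

  mod-cong : ∀ {x y} → x % n ≡ y % n → x mod n ≡ y mod n
  mod-cong {x} {y} eq = toℕ-injective (trans (toℕ-mod x) (trans eq (sym (toℕ-mod y))))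

  <⇒mod-toℕ : ∀ {x} → x < n → toℕ (x mod n) ≡ x
  <⇒mod-toℕ {x} x<n = trans (toℕ-mod x) (m<n⇒m%n≡m x<n)

  toℕ-mod-id : ∀ (i : Fin n) → toℕ i mod n ≡ i
  toℕ-mod-id i = toℕ-injective (<⇒mod-toℕ (toℕ<n i))

module _ {m : ℕ} where

  path-symmetric : Symmetric (Adj (P m))
  path-symmetric = Sum.swap

  path-walk : ∀ {i i' : Fin m} t → toℕ i + t ≡ toℕ i' → Walk (P m) i i' t
  path-walk {i} zero i+0≡i' =
    subst (λ z → Walk (P m) i z 0) (toℕ-injective (trans (sym (+-identityʳ _)) i+0≡i')) here
  path-walk {i} {i'} (suc t) i+1+t≡i' =
    step (inj₁ (sym (toℕ-fromℕ< i+1<m)))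
      (path-walk t (trans (cong (_+ t) (toℕ-fromℕ< i+1<m)) i+1+t≡i'′))
    where
    i+1+t≡i'′ : suc (toℕ i) + t ≡ toℕ i'
    i+1+t≡i'′ = trans (sym (+-suc _ t)) i+1+t≡i'
    i+1<m : suc (toℕ i) < m
    i+1<m = ≤-<-trans (≤-trans (m≤m+n (suc (toℕ i)) t) (≤-reflexive i+1+t≡i'′)) (toℕ<n i')

  path-Lipschitz : Lipschitz (P m) (λ i i' → ∣ toℕ i - toℕ i' ∣)
  path-Lipschitz z = ∣-∣-step (toℕ z)

module Cycle (n : ℕ) {{_ : NonZero n}} where

  cyc : ℕ → ℕ
  cyc d = d ⊓ (n ∸ d)

  cycle-symmetric : Symmetric (Adj (C n))
  cycle-symmetric = Sum.swap

  mod-step : ∀ x → Adj (C n) (x mod n) (suc x mod n)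
  mod-step x with suc (x % n) <? n
  ... | yes x%n+1<n = inj₁ (inj₁ (begin
    suc (toℕ (x mod n))   ≡⟨ cong suc (toℕ-mod x) ⟩
    suc (x % n)           ≡⟨ sym (m<n⇒m%n≡m x%n+1<n) ⟩
    suc (x % n) % n       ≡⟨ sym ([1+m]%n≡[1+m%n]%n x n) ⟩
    suc x % n             ≡⟨ sym (toℕ-mod (suc x)) ⟩
    toℕ (suc x mod n)     ∎))
    where open ≡-Reasoning
  ... | no x%n+1≮n = inj₁ (inj₂ (trans (cong suc (toℕ-mod x)) x%n+1≡n , (begin
    toℕ (suc x mod n)     ≡⟨ toℕ-mod (suc x) ⟩
    suc x % n             ≡⟨ [1+m]%n≡[1+m%n]%n x n ⟩
    suc (x % n) % n       ≡⟨ cong (_% n) x%n+1≡n ⟩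
    n % n                 ≡⟨ n%n≡0 n ⟩
    0                     ∎)))
    where
    open ≡-Reasoning
    x%n+1≡n : suc (x % n) ≡ n
    x%n+1≡n = ≤∧≮⇒≡ (m%n<n x n) x%n+1≮n

  cycle-walk : ∀ x t → Walk (C n) (x mod n) ((x + t) mod n) t
  cycle-walk x zero    = subst (λ z → Walk (C n) (x mod n) (z mod n) 0) (sym (+-identityʳ x)) here
  cycle-walk x (suc t) =
    step (mod-step x) (subst (λ z → Walk (C n) (suc x mod n) (z mod n) t) (sym (+-suc x t)) (cycle-walk (suc x) t))

  cyc-step : ∀ {d d'} → d ≤ suc d' → d' ≤ suc d → cyc d ≤ suc (cyc d')
  cyc-step {d} {d'} d≤1+d' d'≤1+d =
    ⊓-glb (≤-trans (m⊓n≤m d (n ∸ d)) d≤1+d') (≤-trans (m⊓n≤n d (n ∸ d)) n∸d≤1+n∸d')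
    where
    n∸d≤1+n∸d' : n ∸ d ≤ suc (n ∸ d')
    n∸d≤1+n∸d' = m≤n+o⇒m∸n≤o n d (begin
      n                   ≤⟨ m≤n+m∸n n d' ⟩
      d' + (n ∸ d')       ≤⟨ +-monoˡ-≤ (n ∸ d') d'≤1+d ⟩
      suc d + (n ∸ d')    ≡⟨ sym (+-suc d (n ∸ d')) ⟩
      d + suc (n ∸ d')    ∎)
      where open ≤-Reasoning

  cyc-reflect : ∀ {d} → d ≤ n → cyc (n ∸ d) ≡ cyc d
  cyc-reflect {d} d≤n = trans (cong ((n ∸ d) ⊓_) (m∸[m∸n]≡n d≤n)) (⊓-comm (n ∸ d) d)

  cyc-short : ∀ {t} → t + t ≤ n → cyc t ≡ t
  cyc-short {t} 2t≤n = m≤n⇒m⊓n≡m (m+n≤o⇒m≤o∸n t 2t≤n)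

  cyc-wrap : ∀ {j z} → suc j ≡ n → z < n → cyc ∣ j - z ∣ ≡ cyc (suc z)
  cyc-wrap {j} {z} 1+j≡n z<n = begin
    cyc ∣ j - z ∣      ≡⟨ cong cyc (m≤n⇒∣n-m∣≡n∸m (≤-pred (subst (z <_) (sym 1+j≡n) z<n))) ⟩
    cyc (j ∸ z)        ≡⟨ cong (λ l → cyc (l ∸ suc z)) 1+j≡n ⟩
    cyc (n ∸ suc z)    ≡⟨ cyc-reflect z<n ⟩
    cyc (suc z)        ∎
    where open ≡-Reasoning

  cycle-Lipschitz : Lipschitz (C n) (λ j j' → cyc ∣ toℕ j - toℕ j' ∣)
  cycle-Lipschitz z (inj₁ (inj₁ e)) = cyc-step (∣-∣-step (toℕ z) (inj₁ e)) (∣-∣-step (toℕ z) (inj₂ e))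
  cycle-Lipschitz z (inj₂ (inj₁ e)) = cyc-step (∣-∣-step (toℕ z) (inj₂ e)) (∣-∣-step (toℕ z) (inj₁ e))
  cycle-Lipschitz z (inj₁ (inj₂ (1+j≡n , j'≡0))) =
    subst₂ (λ l r → l ≤ suc (cyc ∣ r - toℕ z ∣)) (sym (cyc-wrap 1+j≡n (toℕ<n z))) (sym j'≡0)
      (cyc-step ≤-refl (m≤n⇒m≤1+n (n≤1+n (toℕ z))))
  cycle-Lipschitz z (inj₂ (inj₂ (1+j'≡n , j≡0))) =
    subst₂ (λ l r → cyc ∣ l - toℕ z ∣ ≤ suc r) (sym j≡0) (sym (cyc-wrap 1+j'≡n (toℕ<n z)))
      (cyc-step (m≤n⇒m≤1+n (n≤1+n (toℕ z))) ≤-refl)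

  cyc-offset : ∀ {r t} → r < n → t + t ≤ n → cyc ∣ r - (r + t) % n ∣ ≡ t
  cyc-offset {r} {t} r<n 2t≤n with r + t <? n
  ... | yes r+t<n = begin
    cyc ∣ r - (r + t) % n ∣    ≡⟨ cong (λ l → cyc ∣ r - l ∣) (m<n⇒m%n≡m r+t<n) ⟩
    cyc ∣ r - r + t ∣          ≡⟨ cong cyc (∣m-m+n∣≡n r t) ⟩
    cyc t                      ≡⟨ cyc-short 2t≤n ⟩
    t                          ∎
    where open ≡-Reasoning
  ... | no r+t≮n = begin
    cyc ∣ r - (r + t) % n ∣    ≡⟨ cong (λ l → cyc ∣ r - l ∣) (trans (sym (m≤n⇒[n∸m]%m≡n%m n≤r+t))
                                                              (m<n⇒m%n≡m w<n)) ⟩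
    cyc ∣ r - w ∣              ≡⟨ cong cyc (m≤n⇒∣n-m∣≡n∸m w≤r) ⟩
    cyc (r ∸ w)                ≡⟨ cong cyc r∸w≡n∸t ⟩
    cyc (n ∸ t)                ≡⟨ cyc-reflect t≤n ⟩
    cyc t                      ≡⟨ cyc-short 2t≤n ⟩
    t                          ∎
    where
    open ≡-Reasoning
    w = r + t ∸ n
    n≤r+t : n ≤ r + t
    n≤r+t = ≮⇒≥ r+t≮n
    t≤n : t ≤ n
    t≤n = ≤-trans (m≤m+n t t) 2t≤n
    w≤r : w ≤ r
    w≤r = m≤n+o⇒m∸n≤o (r + t) n (≤-trans (+-monoʳ-≤ r t≤n) (≤-reflexive (+-comm r n)))
    w<n : w < n
    w<n = m<n+o⇒m∸n<o (r + t) n (+-mono-<-≤ r<n t≤n)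
    r∸w≡n∸t : r ∸ w ≡ n ∸ t
    r∸w≡n∸t = begin
      r ∸ w               ≡⟨ sym ([m+n]∸[m+o]≡n∸o t r w) ⟩
      t + r ∸ (t + w)     ≡⟨ cong₂ _∸_ (+-comm t r) (+-comm t w) ⟩
      r + t ∸ (w + t)     ≡⟨ cong (_∸ (w + t)) (sym (m∸n+n≡m n≤r+t)) ⟩
      w + n ∸ (w + t)     ≡⟨ [m+n]∸[m+o]≡n∸o w n t ⟩
      n ∸ t               ∎

module _ {m : ℕ} {{_ : NonZero m}} where

  path-walk-ascending : ∀ {a b} → a ≤ b → a < m → b < m → Walk (P m) (a mod m) (b mod m) (b ∸ a)
  path-walk-ascending {a} {b} a≤b a<m b<m =
    path-walk (b ∸ a)
      (trans (cong (_+ (b ∸ a)) (<⇒mod-toℕ a<m)) (trans (m+[n∸m]≡n a≤b) (sym (<⇒mod-toℕ b<m))))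

  path-walk-∣-∣ : ∀ {a b} → a < m → b < m → Walk (P m) (a mod m) (b mod m) ∣ a - b ∣
  path-walk-∣-∣ {a} {b} a<m b<m with ≤-total a b
  ... | inj₁ a≤b = subst (Walk (P m) _ _) (sym (m≤n⇒∣m-n∣≡n∸m a≤b)) (path-walk-ascending a≤b a<m b<m)
  ... | inj₂ b≤a = subst (Walk (P m) _ _) (sym (m≤n⇒∣n-m∣≡n∸m b≤a))
                     (reverseʷ path-symmetric (path-walk-ascending b≤a b<m a<m))

module PathCycle (m n : ℕ) {{_ : NonZero m}} {{_ : NonZero n}} where
  open Cycle n

  G : Graph
  G = P m □ C n

  -- Opaque so that a and x can be read off ⟨ a , x ⟩ by unification.
  opaque
    ⟨_,_⟩ : ℕ → ℕ → V G
    ⟨ a , x ⟩ = a mod m , x mod n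

  G-symmetric : Symmetric (Adj G)
  G-symmetric = □-symmetric path-symmetric cycle-symmetric

  grid-metric : V G → V G → ℕ
  grid-metric u w = ∣ toℕ (proj₁ u) - toℕ (proj₁ w) ∣ + cyc ∣ toℕ (proj₂ u) - toℕ (proj₂ w) ∣

  grid-metric-refl : ∀ u → grid-metric u u ≡ 0
  grid-metric-refl (i , j) = cong₂ (λ d e → d + cyc e) (∣n-n∣≡0 (toℕ i)) (∣n-n∣≡0 (toℕ j))

  grid-Lipschitz : Lipschitz G grid-metric
  grid-Lipschitz = □-Lipschitz {G = P m} {H = C n} path-Lipschitz cycle-Lipschitz

  opaque
    unfolding ⟨_,_⟩

    ⟨,⟩-cong : ∀ {a x y} → x % n ≡ y % n → ⟨ a , x ⟩ ≡ ⟨ a , y ⟩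
    ⟨,⟩-cong {a} {x} {y} x≡y = cong (a mod m ,_) (mod-cong {x = x} {y} x≡y)

    ⟨toℕ,toℕ⟩ : ∀ u → ⟨ toℕ (proj₁ u) , toℕ (proj₂ u) ⟩ ≡ u
    ⟨toℕ,toℕ⟩ (i , j) = cong₂ _,_ (toℕ-mod-id i) (toℕ-mod-id j)

    distance : ∀ {a b x t} → a < m → b < m → t + t ≤ n → Dist G ⟨ a , x ⟩ ⟨ b , x + t ⟩ (∣ a - b ∣ + t)
    distance {a} {b} {x} {t} a<m b<m 2t≤n =
      Lipschitz⇒Dist grid-Lipschitz grid-metric-refl
        (□-walkˡ (path-walk-∣-∣ a<m b<m) ++ʷ □-walkʳ (cycle-walk x t)) (≤-reflexive (sym metric≡))
      where
      metric≡ : grid-metric ⟨ a , x ⟩ ⟨ b , x + t ⟩ ≡ ∣ a - b ∣ + t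
      metric≡ = cong₂ _+_ (cong₂ ∣_-_∣ (<⇒mod-toℕ a<m) (<⇒mod-toℕ b<m))
                  (trans (cong₂ (λ r r' → cyc ∣ r - r' ∣) (toℕ-mod x) (toℕ-mod (x + t)))
                    (trans (cong (λ r → cyc ∣ x % n - r ∣) ([m+o]%n≡[m%n+o]%n x t n))
                      (cyc-offset (m%n<n x n) 2t≤n)))

least : ∀ {P : ℕ → Set} → Decidable P → ∀ {n} → P n → ∃ λ i → P i × (∀ {j} → j < i → ¬ P j)
least P? {zero} p = 0 , p , λ ()
least P? {suc n} p with P? 0
... | yes p₀ = 0 , p₀ , λ ()
... | no ¬p₀ with least (λ i → P? (suc i)) p
...   | i , pᵢ , below = suc i , pᵢ , λ { {zero} _ → ¬p₀ ; {suc j} j<i → below (≤-pred j<i) }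

data EvenOrOdd : ℕ → Set where
  even : ∀ u → EvenOrOdd (u + u)
  odd  : ∀ u → EvenOrOdd (suc (u + u))

even-or-odd : ∀ t → EvenOrOdd t
even-or-odd zero = even 0
even-or-odd (suc t) with even-or-odd t
... | even u = odd u
... | odd u  = subst EvenOrOdd (cong suc (+-suc u u)) (even (suc u))

module _ {A : Set} {p q x : A} where

  apartˡ : p ≡ x → q ≢ x → p ≢ q
  apartˡ p≡x q≢x p≡q = q≢x (trans (sym p≡q) p≡x)

  apartʳ : p ≢ x → q ≡ x → p ≢ q
  apartʳ p≢x q≡x p≡q = p≢x (trans p≡q q≡x)

  apart : ∀ {y} → p ≡ x → q ≡ y → x ≢ y → p ≢ q
  apart refl refl x≢y = x≢y

other-two : ∀ (x : Fin 3) → ∃₂ λ y z → y ≢ z × y ≢ x × z ≢ x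
other-two zero             = suc zero , suc (suc zero) , (λ ()) , (λ ()) , (λ ())
other-two (suc zero)       = zero , suc (suc zero) , (λ ()) , (λ ()) , (λ ())
other-two (suc (suc zero)) = zero , suc zero , (λ ()) , (λ ()) , (λ ())

third : ∀ (x y : Fin 3) → ∃ λ z → z ≢ x × z ≢ y
third zero             zero             = suc zero , (λ ()) , (λ ())
third zero             (suc zero)       = suc (suc zero) , (λ ()) , (λ ())
third zero             (suc (suc zero)) = suc zero , (λ ()) , (λ ())
third (suc zero)       zero             = suc (suc zero) , (λ ()) , (λ ())
third (suc zero)       (suc zero)       = zero , (λ ()) , (λ ())
third (suc zero)       (suc (suc zero)) = zero , (λ ()) , (λ ())
third (suc (suc zero)) zero             = suc zero , (λ ()) , (λ ())
third (suc (suc zero)) (suc zero)       = zero , (λ ()) , (λ ())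
third (suc (suc zero)) (suc (suc zero)) = zero , (λ ()) , (λ ())

Distinct : {A : Set} → A → A → A → Set
Distinct a b c = a ≢ b × b ≢ c × a ≢ c

at-2-or-4 : ∀ {A : Set} (c₁ c₂ c₃ c₄ : A) → (∀ y → c₁ ≡ y ⊎ c₂ ≡ y ⊎ c₃ ≡ y ⊎ c₄ ≡ y) →
            ∀ {w} → w ≢ c₁ → w ≢ c₃ → c₂ ≡ w ⊎ c₄ ≡ w
at-2-or-4 c₁ c₂ c₃ c₄ covers {w} w≢c₁ w≢c₃ with covers w
... | inj₁ c₁≡w               = ⊥-elim (w≢c₁ (sym c₁≡w))
... | inj₂ (inj₁ c₂≡w)        = inj₁ c₂≡w
... | inj₂ (inj₂ (inj₁ c₃≡w)) = ⊥-elim (w≢c₃ (sym c₃≡w))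
... | inj₂ (inj₂ (inj₂ c₄≡w)) = inj₂ c₄≡w

square-rainbow : ∀ (c₁ c₂ c₃ c₄ : Fin 3) → (∀ y → c₁ ≡ y ⊎ c₂ ≡ y ⊎ c₃ ≡ y ⊎ c₄ ≡ y) →
                 Distinct c₁ c₂ c₃ ⊎ Distinct c₁ c₄ c₃ ⊎ Distinct c₂ c₁ c₄
square-rainbow c₁ c₂ c₃ c₄ covers with c₁ ≟ c₃
... | no c₁≢c₃ = different (third c₁ c₃)
  where
  different : (∃ λ z → z ≢ c₁ × z ≢ c₃) →
              Distinct c₁ c₂ c₃ ⊎ Distinct c₁ c₄ c₃ ⊎ Distinct c₂ c₁ c₄
  different (z , z≢c₁ , z≢c₃) with at-2-or-4 c₁ c₂ c₃ c₄ covers z≢c₁ z≢c₃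
  ... | inj₁ c₂≡z = inj₁ (apartʳ (≢-sym z≢c₁) c₂≡z , apartˡ c₂≡z (≢-sym z≢c₃) , c₁≢c₃)
  ... | inj₂ c₄≡z = inj₂ (inj₁ (apartʳ (≢-sym z≢c₁) c₄≡z , apartˡ c₄≡z (≢-sym z≢c₃) , c₁≢c₃))
... | yes refl = equal (other-two c₁)
  where
  equal : (∃₂ λ y z → y ≢ z × y ≢ c₁ × z ≢ c₁) →
          Distinct c₁ c₂ c₁ ⊎ Distinct c₁ c₄ c₁ ⊎ Distinct c₂ c₁ c₄
  equal (y , z , y≢z , y≢c₁ , z≢c₁)
    with at-2-or-4 c₁ c₂ c₁ c₄ covers y≢c₁ y≢c₁ | at-2-or-4 c₁ c₂ c₁ c₄ covers z≢c₁ z≢c₁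
  ... | inj₁ c₂≡y | inj₁ c₂≡z = ⊥-elim (y≢z (trans (sym c₂≡y) c₂≡z))
  ... | inj₂ c₄≡y | inj₂ c₄≡z = ⊥-elim (y≢z (trans (sym c₄≡y) c₄≡z))
  ... | inj₁ c₂≡y | inj₂ c₄≡z =
    inj₂ (inj₂ (apartˡ c₂≡y (≢-sym y≢c₁) , apartʳ (≢-sym z≢c₁) c₄≡z , apart c₂≡y c₄≡z y≢z))
  ... | inj₂ c₄≡y | inj₁ c₂≡z =
    inj₂ (inj₂ (apartˡ c₂≡z (≢-sym z≢c₁) , apartʳ (≢-sym y≢c₁) c₄≡y , apart c₂≡z c₄≡y (≢-sym y≢z)))

module Windows (Occurs : ℕ → Fin 3 → Set) (occurs? : ∀ i y → Dec (Occurs i y)) where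

  OccursWithin : ℕ → ℕ → Fin 3 → Set
  OccursWithin s h y = ∃ λ d → d ≤ h × Occurs (s + d) y

  occurs-within? : ∀ s h y → Dec (OccursWithin s h y)
  occurs-within? s h y = map′ (λ (d , d<1+h , o) → d , ≤-pred d<1+h , o) (λ (d , d≤h , o) → d , s≤s d≤h , o)
                              (anyUpTo? (λ d → occurs? (s + d) y) (suc h))

  Spans : ℕ → ℕ → Set
  Spans s h = ∀ y → OccursWithin s h y

  spans? : ∀ s h → Dec (Spans s h)
  spans? s h = all? (occurs-within? s h)

  record Ends (s h : ℕ) : Set where
    field
      X Y          : Fin 3
      X≢Y          : X ≢ Y
      X-first      : Occurs s X
      Y-last       : Occurs (s + h) Y
      X-only-first : ∀ {d} → 0 < d → d ≤ h → ¬ Occurs (s + d) X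
      Y-only-last  : ∀ {d} → d < h → ¬ Occurs (s + d) Y

  ends : ∀ {s h} → Spans s (suc h) → ¬ Spans (suc s) h → ¬ Spans s h → Ends s (suc h)
  ends {s} {h} spans ¬spans-later ¬spans-earlier = record
    { X = X ; Y = Y ; X≢Y = X≢Y ; X-first = X-first ; Y-last = Y-last
    ; X-only-first = X-only-first ; Y-only-last = Y-only-last }
    where
    missing-later  = ¬∀⟶∃¬ 3 _ (occurs-within? (suc s) h) ¬spans-later
    missing-earlier = ¬∀⟶∃¬ 3 _ (occurs-within? s h) ¬spans-earlier
    X = proj₁ missing-later
    Y = proj₁ missing-earlier

    X-only-first : ∀ {d} → 0 < d → d ≤ suc h → ¬ Occurs (s + d) X
    X-only-first {suc d} _ d<1+h occ =
      proj₂ missing-later (d , ≤-pred d<1+h , subst (λ i → Occurs i X) (+-suc s d) occ)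

    Y-only-last : ∀ {d} → d < suc h → ¬ Occurs (s + d) Y
    Y-only-last {d} d<1+h occ = proj₂ missing-earlier (d , ≤-pred d<1+h , occ)

    X-first : Occurs s X
    X-first with spans X
    ... | zero  , _ , occ       = subst (λ i → Occurs i X) (+-identityʳ s) occ
    ... | suc d , d<1+h , occ   = ⊥-elim (X-only-first z<s d<1+h occ)

    Y-last : Occurs (s + suc h) Y
    Y-last with spans Y
    ... | d , d≤1+h , occ with d <? suc h
    ...   | yes d<1+h = ⊥-elim (Y-only-last d<1+h occ)
    ...   | no d≮1+h  = subst (λ d → Occurs (s + d) Y) (≤∧≮⇒≡ d≤1+h d≮1+h) occ

    X≢Y : X ≢ Y
    X≢Y X≡Y = Y-only-last z<s (subst₂ Occurs (sym (+-identityʳ s)) X≡Y X-first)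

-- Colour patterns of a triple, where Z stands for any colour other than X and Y.
module _ {A : Set} {X Y : A} (X≢Y : X ≢ Y) where

  Other : A → Set
  Other z = z ≢ X × z ≢ Y

  XZY : ∀ {p q r} → p ≡ X → Other q → r ≡ Y → Distinct p q r
  XZY p≡X (q≢X , q≢Y) r≡Y = apartˡ p≡X q≢X , apartʳ q≢Y r≡Y , apart p≡X r≡Y X≢Y

  YZX : ∀ {p q r} → p ≡ Y → Other q → r ≡ X → Distinct p q r
  YZX p≡Y (q≢X , q≢Y) r≡X = apartˡ p≡Y q≢Y , apartʳ q≢X r≡X , apart p≡Y r≡X (≢-sym X≢Y)

  YXZ : ∀ {p q r} → p ≡ Y → q ≡ X → Other r → Distinct p q r
  YXZ p≡Y q≡X (r≢X , r≢Y) = apart p≡Y q≡X (≢-sym X≢Y) , apartˡ q≡X r≢X , apartˡ p≡Y r≢Y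

  XYZ : ∀ {p q r} → p ≡ X → q ≡ Y → Other r → Distinct p q r
  XYZ p≡X q≡Y (r≢X , r≢Y) = apart p≡X q≡Y X≢Y , apartˡ q≡Y r≢Y , apartˡ p≡X r≢X

u+u≤k+k⇒u≤k : ∀ {u k} → u + u ≤ k + k → u ≤ k
u+u≤k+k⇒u≤k u+u≤k+k = ≮⇒≥ λ k<u → <⇒≱ (+-mono-< k<u k<u) u+u≤k+k

u+u<k+k⇒u<k : ∀ {u k} → u + u < k + k → u < k
u+u<k+k⇒u<k u+u<k+k = ≰⇒> λ k≤u → <⇒≱ u+u<k+k (+-mono-≤ k≤u k≤u)

half-pos : ∀ {u} → 2 ≤ u + u → 0 < u
half-pos {suc u} _ = z<s

half-pos′ : ∀ {u} → 2 ≤ suc (u + u) → 0 < u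
half-pos′ {zero} (s≤s ())
half-pos′ {suc u} _ = z<s

m+n+1≡m+1+n : ∀ a b → a + b + 1 ≡ a + suc b
m+n+1≡m+1+n a b = trans (+-assoc a b 1) (cong (a +_) (+-comm b 1))

module PathOddCycle (m′ k′ : ℕ) where

  m k n : ℕ
  m = suc (suc m′)
  k = suc k′
  n = suc (k + k)

  open PathCycle m n

  infix 4 _≡ₙ_
  _≡ₙ_ : ℕ → ℕ → Set
  x ≡ₙ y = x % n ≡ y % n

  dist : ∀ {a b x y t r} → a < m → b < m → t ≤ k → x + t ≡ₙ y → ∣ a - b ∣ ≡ r →
         Dist G ⟨ a , x ⟩ ⟨ b , y ⟩ (r + t)
  dist {a} {b} {x} {y} {t} a<m b<m t≤k x+t≡y ∣a-b∣≡r =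
    subst₂ (Dist G ⟨ a , x ⟩) (⟨,⟩-cong x+t≡y) (cong (_+ t) ∣a-b∣≡r)
      (distance a<m b<m (≤-trans (+-mono-≤ t≤k t≤k) (n≤1+n (k + k))))

  dist˘ : ∀ {a b x y t r} → a < m → b < m → t ≤ k → x + t ≡ₙ y → ∣ a - b ∣ ≡ r →
          Dist G ⟨ b , y ⟩ ⟨ a , x ⟩ (r + t)
  dist˘ a<m b<m t≤k x+t≡y ∣a-b∣≡r = Dist-sym G-symmetric (dist a<m b<m t≤k x+t≡y ∣a-b∣≡r)

  wraps-around : ∀ a {t w} → t + w ≡ n → a + t + w ≡ₙ a
  wraps-around a {t} {w} t+w≡n =
    trans (cong (_% n) (trans (+-assoc a t w) (cong (a +_) t+w≡n))) ([m+n]%n≡m%n a n)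

  ≡⇒≡ₙ : ∀ {x y} → x ≡ y → x ≡ₙ y
  ≡⇒≡ₙ = cong (_% n)

  offset : ∀ {a b} → a < n → b < n → ∃ λ e → e < n × a + e ≡ₙ b
  offset {a} {b} a<n b<n with a ≤? b
  ... | yes a≤b = b ∸ a , ≤-<-trans (m∸n≤m b a) b<n , ≡⇒≡ₙ (m+[n∸m]≡n a≤b)
  ... | no a≰b  = b + n ∸ a , m<n+o⇒m∸n<o (b + n) a (+-monoˡ-< n (≰⇒> a≰b)) ,
                  trans (≡⇒≡ₙ (m+[n∸m]≡n (≤-trans (<⇒≤ a<n) (m≤n+m n b)))) ([m+n]%n≡m%n b n)

  module Colouring (c : V G → Fin 3) where

    κ : ℕ → ℕ → Fin 3
    κ a x = c ⟨ a , x ⟩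

    κ-≡ₙ : ∀ {a x y} → x ≡ₙ y → κ a x ≡ κ a y
    κ-≡ₙ x≡y = cong c (⟨,⟩-cong x≡y)

    Rainbow : Set
    Rainbow = HasRainbow3AP G c

    rainbow : ∀ u v w {d} → Distinct (c u) (c v) (c w) → Dist G u v d → Dist G v w d → Rainbow
    rainbow u v w (u≢v , v≢w , u≢w) u-v v-w = u , v , w , u≢v , v≢w , u≢w , _ , u-v , v-w

    InRow : ℕ → Fin 3 → Set
    InRow i y = ∃ λ x → x < n × κ i x ≡ y

    module Rows = Windows InRow (λ i y → anyUpTo? (λ x → κ i x ≟ y) n)

    ¬InRow⇒≢ : ∀ {i y} → ¬ InRow i y → ∀ x → κ i x ≢ y
    ¬InRow⇒≢ ¬in x κ≡y = ¬in (x % n , m%n<n x n , trans (κ-≡ₙ (m%n%n≡m%n x n)) κ≡y)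

    module RowEnds {s h} (s+h<m : s + h < m) (E : Rows.Ends s h) where
      open Rows.Ends E

      s<m : s < m
      s<m = ≤-<-trans (m≤m+n s h) s+h<m

      row< : ∀ {q} → q ≤ h → s + q < m
      row< q≤h = ≤-<-trans (+-monoʳ-≤ s q≤h) s+h<m

      between : ∀ {q} → 0 < q → q < h → ∀ x → Other X≢Y (κ (s + q) x)
      between 0<q q<h x = ¬InRow⇒≢ (X-only-first 0<q (<⇒≤ q<h)) x , ¬InRow⇒≢ (Y-only-last q<h) x

      ∣s-s+q∣ : ∀ q → ∣ s - s + q ∣ ≡ q
      ∣s-s+q∣ = ∣m-m+n∣≡n s

      ∣s+q-s∣ : ∀ q → ∣ s + q - s ∣ ≡ q
      ∣s+q-s∣ q = trans (∣-∣-comm (s + q) s) (∣s-s+q∣ q)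

      ∣s+q-s+2q∣ : ∀ q → ∣ s + q - s + (q + q) ∣ ≡ q
      ∣s+q-s+2q∣ q = trans (∣m+n-m+o∣≡∣n-o∣ s q (q + q)) (∣m-m+n∣≡n q q)

      ∣s+q-s+1+2q∣ : ∀ q → ∣ s + q - s + suc (q + q) ∣ ≡ suc q
      ∣s+q-s+1+2q∣ q = trans (∣m+n-m+o∣≡∣n-o∣ s q (suc (q + q)))
                        (trans (cong (∣ q -_∣) (sym (+-suc q q))) (∣m-m+n∣≡n q (suc q)))

      ∣s+1+2q-s+q∣ : ∀ q → ∣ s + suc (q + q) - s + q ∣ ≡ suc q
      ∣s+1+2q-s+q∣ q = trans (∣-∣-comm (s + suc (q + q)) (s + q)) (∣s+q-s+1+2q∣ q)

      rainbow-across : 2 ≤ h → ∀ a e → κ s a ≡ X → κ (s + h) (a + e) ≡ Y → e < n → Rainbow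
      rainbow-across 2≤h a e hX hY e<n with even-or-odd h | even-or-odd e
      ... | even q | even u =
        rainbow ⟨ s , a ⟩ ⟨ s + q , a + u ⟩ ⟨ s + (q + q) , a + (u + u) ⟩
          (XZY X≢Y hX (between 0<q q<h (a + u)) hY)
          (dist s<m (row< q≤h) u≤k refl (∣s-s+q∣ q))
          (dist (row< q≤h) s+h<m u≤k (≡⇒≡ₙ (+-assoc a u u)) (∣s+q-s+2q∣ q))
        where
        0<q = half-pos 2≤h
        q<h = m<m+n q 0<q
        q≤h = <⇒≤ q<h
        u≤k = u+u≤k+k⇒u≤k {u} (≤-pred e<n)
      ... | even q | odd u =
        rainbow ⟨ s + (q + q) , a + suc (u + u) ⟩ ⟨ s + q , a + suc (u + k) ⟩ ⟨ s , a ⟩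
          (YZX X≢Y hY (between 0<q q<h (a + suc (u + k))) hX)
          (dist s+h<m (row< q≤h) w≤k (≡⇒≡ₙ e+w) (trans (∣-∣-comm (s + (q + q)) (s + q)) (∣s+q-s+2q∣ q)))
          (dist (row< q≤h) s<m w≤k (wraps-around a wrap) (∣s+q-s∣ q))
        where
        0<q = half-pos 2≤h
        q<h = m<m+n q 0<q
        q≤h = <⇒≤ q<h
        u<k = u+u<k+k⇒u<k {u} (≤-pred e<n)
        w = k ∸ u
        u+w≡k : u + w ≡ k
        u+w≡k = m+[n∸m]≡n (<⇒≤ u<k)
        w≤k = m∸n≤m k u
        e+w : a + suc (u + u) + w ≡ a + suc (u + k)
        e+w = trans (+-assoc a (suc (u + u)) w)
                (cong (λ l → a + suc l) (trans (+-assoc u u w) (cong (u +_) u+w≡k)))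
        wrap : suc (u + k) + w ≡ n
        wrap = cong suc (trans (xy∙z≈xz∙y u k w) (cong (_+ k) u+w≡k))
      ... | odd q | even zero =
        rainbow ⟨ s + suc (q + q) , a + 0 ⟩ ⟨ s , a ⟩ ⟨ s + (q + q) , a + 1 ⟩
          (YXZ X≢Y hY hX (between 0<2q (n<1+n (q + q)) (a + 1)))
          (subst (Dist G _ _) (trans (+-identityʳ _) (+-comm 1 (q + q)))
            (dist s+h<m s<m z≤n (≡⇒≡ₙ (trans (+-identityʳ (a + 0)) (+-identityʳ a))) (∣s+q-s∣ (suc (q + q)))))
          (dist s<m (row< (n≤1+n (q + q))) (s≤s z≤n) refl (∣s-s+q∣ (q + q)))
        where
        0<2q = ≤-pred 2≤h
      ... | odd q | even (suc u) =
        rainbow ⟨ s + suc (q + q) , a + (suc u + suc u) ⟩ ⟨ s + q , a + (suc u + k) ⟩ ⟨ s , a ⟩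
          (YZX X≢Y hY (between 0<q q<h (a + (suc u + k))) hX)
          (dist s+h<m (row< q≤h) w≤k (≡⇒≡ₙ e+w) (∣s+1+2q-s+q∣ q))
          (subst (Dist G _ _) (+-suc q w) (dist (row< q≤h) s<m 1+w≤k (wraps-around a wrap) (∣s+q-s∣ q)))
        where
        0<q = half-pos′ 2≤h
        q<h = s≤s (m≤m+n q q)
        q≤h = <⇒≤ q<h
        U = suc u
        U≤k = u+u≤k+k⇒u≤k {U} (≤-pred e<n)
        w = k ∸ U
        U+w≡k : U + w ≡ k
        U+w≡k = m+[n∸m]≡n U≤k
        w≤k = m∸n≤m k U
        1+w≤k : suc w ≤ k
        1+w≤k = subst (suc w ≤_) U+w≡k (+-monoˡ-≤ w (s≤s z≤n))
        e+w : a + (U + U) + w ≡ a + (U + k)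
        e+w = trans (+-assoc a (U + U) w) (cong (a +_) (trans (+-assoc U U w) (cong (U +_) U+w≡k)))
        wrap : U + k + suc w ≡ n
        wrap = trans (+-suc (U + k) w) (cong suc (trans (xy∙z≈xz∙y U k w) (cong (_+ k) U+w≡k)))
      ... | odd q | odd u =
        rainbow ⟨ s , a ⟩ ⟨ s + q , a + suc u ⟩ ⟨ s + suc (q + q) , a + suc (u + u) ⟩
          (XZY X≢Y hX (between 0<q q<h (a + suc u)) hY)
          (dist s<m (row< q≤h) u<k refl (∣s-s+q∣ q))
          (subst (Dist G _ _) (sym (+-suc q u))
            (dist (row< q≤h) s+h<m (<⇒≤ u<k) (≡⇒≡ₙ (+-assoc a (suc u) u)) (∣s+q-s+1+2q∣ q)))
        where
        0<q = half-pos′ 2≤h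
        q<h = s≤s (m≤m+n q q)
        q≤h = <⇒≤ q<h
        u<k = u+u<k+k⇒u<k {u} (≤-pred e<n)

      rows-rainbow : 2 ≤ h → Rainbow
      rows-rainbow 2≤h with X-first | Y-last
      ... | a , a<n , hX | b , b<n , hY with offset a<n b<n
      ...   | e , e<n , a+e≡b = rainbow-across 2≤h a e hX (trans (κ-≡ₙ a+e≡b) hY) e<n

    module BandEnds (ρ ρ̄ a L : ℕ) {X Y : Fin 3}
                    (ρ<m : ρ < m) (ρ̄<m : ρ̄ < m) (∣ρ-ρ̄∣≡1 : ∣ ρ - ρ̄ ∣ ≡ 1)
                  (2≤L : 2 ≤ L) (L<n : L < n) (X≢Y : X ≢ Y) (hX : κ ρ a ≡ X)
                  (lacks-X : ∀ {o} → 0 < o → o ≤ L → κ ρ (a + o) ≢ X × κ ρ̄ (a + o) ≢ X)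
                  (lacks-Y : ∀ {o} → o < L → κ ρ (a + o) ≢ Y × κ ρ̄ (a + o) ≢ Y) where

      ∣ρ̄-ρ∣≡1 : ∣ ρ̄ - ρ ∣ ≡ 1
      ∣ρ̄-ρ∣≡1 = trans (∣-∣-comm ρ̄ ρ) ∣ρ-ρ̄∣≡1

      middleρ : ∀ {o} → 0 < o → o < L → Other X≢Y (κ ρ (a + o))
      middleρ 0<o o<L = proj₁ (lacks-X 0<o (<⇒≤ o<L)) , proj₁ (lacks-Y o<L)

      middleρ̄ : ∀ {o} → 0 < o → o < L → Other X≢Y (κ ρ̄ (a + o))
      middleρ̄ 0<o o<L = proj₂ (lacks-X 0<o (<⇒≤ o<L)) , proj₂ (lacks-Y o<L)

      module Far (L≰k : ¬ L ≤ k) where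
        w : ℕ
        w = n ∸ L
        L+w≡n : L + w ≡ n
        L+w≡n = m+[n∸m]≡n (<⇒≤ L<n)
        w≤k : w ≤ k
        w≤k = m≤n+o⇒m∸n≤o n L (+-monoˡ-≤ k (≰⇒> L≰k))
        0<w : 0 < w
        0<w = m<n⇒0<n∸m L<n
        w<L : w < L
        w<L = ≤-<-trans w≤k (≰⇒> L≰k)

      same-row : κ ρ (a + L) ≡ Y → Rainbow
      same-row hY with L ≤? k
      ... | no L≰k =
        rainbow ⟨ ρ , a + L ⟩ ⟨ ρ , a ⟩ ⟨ ρ , a + w ⟩ (YXZ X≢Y hY hX (middleρ 0<w w<L))
          (dist ρ<m ρ<m w≤k (wraps-around a L+w≡n) (∣n-n∣≡0 ρ))
          (dist ρ<m ρ<m w≤k refl (∣n-n∣≡0 ρ))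
        where open Far L≰k
      same-row hY | yes L≤k with even-or-odd L
      ... | even u =
        rainbow ⟨ ρ , a ⟩ ⟨ ρ , a + u ⟩ ⟨ ρ , a + (u + u) ⟩ (XZY X≢Y hX (middleρ 0<u (m<m+n u 0<u)) hY)
          (dist ρ<m ρ<m u≤k refl (∣n-n∣≡0 ρ))
          (dist ρ<m ρ<m u≤k (≡⇒≡ₙ (+-assoc a u u)) (∣n-n∣≡0 ρ))
        where
        0<u = half-pos 2≤L
        u≤k = ≤-trans (m≤m+n u u) L≤k
      ... | odd u =
        rainbow ⟨ ρ , a + suc (u + u) ⟩ ⟨ ρ , a ⟩ ⟨ ρ̄ , a + (u + u) ⟩
          (YXZ X≢Y hY hX (middleρ̄ (≤-pred 2≤L) (n<1+n (u + u))))
          (dist˘ ρ<m ρ<m L≤k refl (∣n-n∣≡0 ρ))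
          (dist ρ<m ρ̄<m (≤-trans (n≤1+n (u + u)) L≤k) refl ∣ρ-ρ̄∣≡1)

      past-end-Y : L ≤ k → κ ρ (a + suc L) ≡ Y → Rainbow
      past-end-Y L≤k hB with m≤n⇒m<n∨m≡n L≤k
      ... | inj₁ L<k =
        rainbow ⟨ ρ , a ⟩ ⟨ ρ , a + suc L ⟩ ⟨ ρ̄ , a + 1 ⟩ (XYZ X≢Y hX hB (middleρ̄ z<s 2≤L))
          (dist ρ<m ρ<m L<k refl (∣n-n∣≡0 ρ))
          (dist˘ ρ̄<m ρ<m L≤k (≡⇒≡ₙ (+-assoc a 1 L)) ∣ρ̄-ρ∣≡1)
      ... | inj₂ refl =
        rainbow ⟨ ρ , a ⟩ ⟨ ρ , a + suc k ⟩ ⟨ ρ , a + 1 ⟩ (XYZ X≢Y hX hB (middleρ z<s 2≤L))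
          (dist˘ ρ<m ρ<m ≤-refl (wraps-around a refl) (∣n-n∣≡0 ρ))
          (dist˘ ρ<m ρ<m ≤-refl (≡⇒≡ₙ (+-assoc a 1 k)) (∣n-n∣≡0 ρ))

      past-end-other : L ≤ k → Other X≢Y (κ ρ (a + L)) → κ ρ̄ (a + L) ≡ Y →
                       Other X≢Y (κ ρ (a + suc L)) → Rainbow
      past-end-other L≤k W hY B with m≤n⇒m<n∨m≡n L≤k
      ... | inj₁ L<k =
        rainbow ⟨ ρ̄ , a + L ⟩ ⟨ ρ , a ⟩ ⟨ ρ , a + suc L ⟩ (YXZ X≢Y hY hX B)
          (dist˘ ρ<m ρ̄<m L≤k refl ∣ρ-ρ̄∣≡1)
          (dist ρ<m ρ<m L<k refl (∣n-n∣≡0 ρ))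
      ... | inj₂ refl with κ ρ̄ (a + suc k) ≟ X | κ ρ̄ (a + suc k) ≟ Y
      ...   | yes hB′ | _ =
        rainbow ⟨ ρ̄ , a + suc k ⟩ ⟨ ρ̄ , a + k ⟩ ⟨ ρ , a + k ⟩ (XYZ X≢Y hB′ hY W)
          (dist˘ ρ̄<m ρ̄<m (s≤s z≤n) (≡⇒≡ₙ (m+n+1≡m+1+n a k)) (∣n-n∣≡0 ρ̄))
          (dist ρ̄<m ρ<m z≤n (≡⇒≡ₙ (+-identityʳ (a + k))) ∣ρ̄-ρ∣≡1)
      ...   | no _ | yes hB′ =
        rainbow ⟨ ρ , a ⟩ ⟨ ρ̄ , a + suc k ⟩ ⟨ ρ , a + 1 ⟩ (XYZ X≢Y hX hB′ (middleρ z<s 2≤L))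
          (dist˘ ρ̄<m ρ<m ≤-refl (wraps-around a refl) ∣ρ̄-ρ∣≡1)
          (dist˘ ρ<m ρ̄<m ≤-refl (≡⇒≡ₙ (+-assoc a 1 k)) ∣ρ-ρ̄∣≡1)
      ...   | no B′≢X | no B′≢Y =
        rainbow ⟨ ρ̄ , a + k ⟩ ⟨ ρ , a ⟩ ⟨ ρ̄ , a + suc k ⟩ (YXZ X≢Y hY hX (B′≢X , B′≢Y))
          (dist˘ ρ<m ρ̄<m ≤-refl refl ∣ρ-ρ̄∣≡1)
          (dist˘ ρ̄<m ρ<m ≤-refl (wraps-around a refl) ∣ρ̄-ρ∣≡1)

      -- For even L ≤ k with the far corner of row ρ neither X nor Y, no rainbow 3-AP need lie
      -- inside the window, and the colour of the next column decides.
      past-end : L ≤ k → Other X≢Y (κ ρ (a + L)) → κ ρ̄ (a + L) ≡ Y → Rainbow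
      past-end L≤k W hY with κ ρ (a + suc L) ≟ X | κ ρ (a + suc L) ≟ Y
      ... | yes hB | _ =
        rainbow ⟨ ρ̄ , a + L ⟩ ⟨ ρ , a + L ⟩ ⟨ ρ , a + suc L ⟩ (YZX X≢Y hY W hB)
          (dist ρ̄<m ρ<m z≤n (≡⇒≡ₙ (+-identityʳ (a + L))) ∣ρ̄-ρ∣≡1)
          (dist ρ<m ρ<m (s≤s z≤n) (≡⇒≡ₙ (m+n+1≡m+1+n a L)) (∣n-n∣≡0 ρ))
      ... | no _ | yes hB = past-end-Y L≤k hB
      ... | no B≢X | no B≢Y = past-end-other L≤k W hY (B≢X , B≢Y)

      other-row : κ ρ̄ (a + L) ≡ Y → Rainbow
      other-row hY with L ≤? k
      ... | no L≰k =
        rainbow ⟨ ρ̄ , a + L ⟩ ⟨ ρ , a ⟩ ⟨ ρ̄ , a + w ⟩ (YXZ X≢Y hY hX (middleρ̄ 0<w w<L))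
          (dist ρ̄<m ρ<m w≤k (wraps-around a L+w≡n) ∣ρ̄-ρ∣≡1)
          (dist ρ<m ρ̄<m w≤k refl ∣ρ-ρ̄∣≡1)
        where open Far L≰k
      other-row hY | yes L≤k with even-or-odd L
      ... | odd u =
        rainbow ⟨ ρ , a ⟩ ⟨ ρ , a + suc u ⟩ ⟨ ρ̄ , a + suc (u + u) ⟩
          (XZY X≢Y hX (middleρ z<s (s≤s (m<m+n u 0<u))) hY)
          (dist ρ<m ρ<m (≤-trans (s≤s (m≤m+n u u)) L≤k) refl (∣n-n∣≡0 ρ))
          (dist ρ<m ρ̄<m (≤-trans (m≤m+n u u) (≤-trans (n≤1+n _) L≤k)) (≡⇒≡ₙ (+-assoc a (suc u) u))
            ∣ρ-ρ̄∣≡1)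
        where
        0<u = half-pos′ 2≤L
      ... | even u with κ ρ (a + (u + u)) ≟ Y
      ...   | yes hW = same-row hW
      ...   | no W≢Y = past-end L≤k (proj₁ (lacks-X (≤-trans (s≤s z≤n) 2≤L) ≤-refl) , W≢Y) hY

    module Band (p : ℕ) (1+p<m : suc p < m) where

      InBand : ℕ → Fin 3 → Set
      InBand x y = κ p x ≡ y ⊎ κ (suc p) x ≡ y

      open Windows InBand (λ x y → (κ p x ≟ y) ⊎-dec (κ (suc p) x ≟ y))

      p<m : p < m
      p<m = <-trans (n<1+n p) 1+p<m

      ∣p-1+p∣≡1 : ∣ p - suc p ∣ ≡ 1
      ∣p-1+p∣≡1 = ∣a-1+a∣≡1 p

      corners : ∀ {a} → Spans a 1 → ∀ y →
                κ p a ≡ y ⊎ κ p (a + 1) ≡ y ⊎ κ (suc p) (a + 1) ≡ y ⊎ κ (suc p) a ≡ y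
      corners {a} spans y with spans y
      ... | 0 , _ , inj₁ e           = inj₁ (trans (cong (κ p) (sym (+-identityʳ a))) e)
      ... | 0 , _ , inj₂ e           = inj₂ (inj₂ (inj₂ (trans (cong (κ (suc p)) (sym (+-identityʳ a))) e)))
      ... | 1 , _ , inj₁ e           = inj₂ (inj₁ e)
      ... | 1 , _ , inj₂ e           = inj₂ (inj₂ (inj₁ e))
      ... | suc (suc _) , s≤s () , _

      horizontal : ∀ x → Dist G ⟨ p , x ⟩ ⟨ p , x + 1 ⟩ 1
      horizontal x = dist p<m p<m (s≤s z≤n) refl (∣n-n∣≡0 p)

      vertical : ∀ x → Dist G ⟨ p , x ⟩ ⟨ suc p , x ⟩ 1
      vertical x = dist p<m 1+p<m z≤n (≡⇒≡ₙ (+-identityʳ x)) ∣p-1+p∣≡1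

      square : ∀ {a} → Spans a 1 → Rainbow
      square {a} spans with square-rainbow _ _ _ _ (corners spans)
      ... | inj₁ distinct        = rainbow ⟨ p , a ⟩ ⟨ p , a + 1 ⟩ ⟨ suc p , a + 1 ⟩ distinct
                                     (horizontal a) (vertical (a + 1))
      ... | inj₂ (inj₁ distinct) = rainbow ⟨ p , a ⟩ ⟨ suc p , a ⟩ ⟨ suc p , a + 1 ⟩ distinct (vertical a)
                                     (dist 1+p<m 1+p<m (s≤s z≤n) refl (∣n-n∣≡0 (suc p)))
      ... | inj₂ (inj₂ distinct) = rainbow ⟨ p , a + 1 ⟩ ⟨ p , a ⟩ ⟨ suc p , a ⟩ distinct
                                     (Dist-sym G-symmetric (horizontal a)) (vertical a)

      wide-window : ∀ {a L} → 2 ≤ L → L < n → Ends a L → Rainbow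
      wide-window {a} {L} 2≤L L<n E = Sum.[ lower , upper ]′ X-first
        where
        open Ends E
        both-rows : ∀ {x y} → ¬ InBand x y → κ p x ≢ y × κ (suc p) x ≢ y
        both-rows ¬in = (λ e → ¬in (inj₁ e)) , (λ e → ¬in (inj₂ e))
        lower : κ p a ≡ X → Rainbow
        lower hX = Sum.[ Lower.same-row , Lower.other-row ]′ Y-last
          where module Lower = BandEnds p (suc p) a L p<m 1+p<m ∣p-1+p∣≡1 2≤L L<n X≢Y hX
                                 (λ 0<o o≤L → both-rows (X-only-first 0<o o≤L))
                                 (λ o<L → both-rows (Y-only-last o<L))
        upper : κ (suc p) a ≡ X → Rainbow
        upper hX = Sum.[ Upper.other-row , Upper.same-row ]′ Y-last
          where module Upper = BandEnds (suc p) p a L 1+p<m p<m (trans (∣-∣-comm (suc p) p) ∣p-1+p∣≡1)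
                                 2≤L L<n X≢Y hX
                                 (λ 0<o o≤L → swap (both-rows (X-only-first 0<o o≤L)))
                                 (λ o<L → swap (both-rows (Y-only-last o<L)))

      -- Columns are periodic, so windows may be taken to start below n.
      shift : ∀ {x h} → Spans x h → Spans (x % n) h
      shift {x} spans y with spans y
      ... | d , d≤h , occ = d , d≤h , Sum.map (trans (κ-≡ₙ x%n+d≡x+d)) (trans (κ-≡ₙ x%n+d≡x+d)) occ
        where
        x%n+d≡x+d : x % n + d ≡ₙ x + d
        x%n+d≡x+d = sym ([m+o]%n≡[m%n+o]%n x d n)

      BandWindow : ℕ → Set
      BandWindow j = ∃ λ a → a < n × Spans a (suc j)

      rainbow-in-band : (∀ y → ∃ λ x → x < n × InBand x y) → Rainbow
      rainbow-in-band all-colours = from-least (least (λ j → anyUpTo? (λ a → spans? a (suc j)) n) (0 , z<s , whole))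
        where
        whole : Spans 0 (suc (k′ + suc k′))
        whole y = let x , x<n , occ = all-colours y in x , ≤-pred x<n , occ

        from-least : (∃ λ i → BandWindow i × (∀ {j} → j < i → ¬ BandWindow j)) → Rainbow
        from-least (zero  , (a , _ , spans) , _) = square spans
        from-least (suc j , (a , a<n , spans) , minimal) =
          wide-window (s≤s (s≤s z≤n)) (s≤s (s≤s (≮⇒≥ λ lt → minimal lt (0 , z<s , whole))))
            (ends spans ¬later ¬earlier)
          where
          ¬later : ¬ Spans (suc a) (suc j)
          ¬later sp = minimal ≤-refl (suc a % n , m%n<n (suc a) n , shift sp)
          ¬earlier : ¬ Spans a (suc j)
          ¬earlier sp = minimal ≤-refl (a , a<n , sp)

    RowWindow : ℕ → Set
    RowWindow j = ∃ λ s → s + suc j < m × Rows.Spans s (suc j)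

    row-window? : ∀ j → Dec (RowWindow j)
    row-window? j = map′ (λ (s , _ , window) → s , window)
                         (λ (s , lt , spans) → s , ≤-<-trans (m≤m+n s (suc j)) lt , lt , spans)
                         (anyUpTo? (λ s → (s + suc j <? m) ×-dec Rows.spans? s (suc j)) m)

    adjacent-rows : ∀ {s} → s + 1 < m → Rows.Spans s 1 → Rainbow
    adjacent-rows {s} s+1<m spans = Band.rainbow-in-band s 1+s<m band-colours
      where
      1+s<m : suc s < m
      1+s<m = subst (_< m) (+-comm s 1) s+1<m
      band-colours : ∀ y → ∃ λ x → x < n × Band.InBand s 1+s<m x y
      band-colours y with spans y
      ... | 0 , _ , x , x<n , e           = x , x<n , inj₁ (trans (cong (λ i → κ i x) (sym (+-identityʳ s))) e)
      ... | 1 , _ , x , x<n , e           = x , x<n , inj₂ (trans (cong (λ i → κ i x) (+-comm 1 s)) e)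
      ... | suc (suc _) , s≤s () , _

    surjective⇒rainbow : Surj c → Rainbow
    surjective⇒rainbow surj = from-least (least row-window? (0 , ≤-refl , whole))
      where
      whole : Rows.Spans 0 (suc m′)
      whole y = let (i , j) , e = surj y in
        toℕ i , ≤-pred (toℕ<n i) , toℕ j , toℕ<n j , trans (cong c (⟨toℕ,toℕ⟩ (i , j))) e

      from-least : (∃ λ i → RowWindow i × (∀ {j} → j < i → ¬ RowWindow j)) → Rainbow
      from-least (zero  , (s , s+1<m , spans) , _) = adjacent-rows s+1<m spans
      from-least (suc j , (s , s+h<m , spans) , minimal) =
        RowEnds.rows-rainbow s+h<m (Rows.ends spans ¬later ¬earlier) (s≤s (s≤s z≤n))
        where
        ¬later : ¬ Rows.Spans (suc s) (suc j)
        ¬later sp = minimal ≤-refl (suc s , subst (_< m) (+-suc s (suc j)) s+h<m , sp)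
        ¬earlier : ¬ Rows.Spans s (suc j)
        ¬earlier sp = minimal ≤-refl (s , ≤-<-trans (+-monoʳ-≤ s (n≤1+n (suc j))) s+h<m , sp)

three-colours-needed : ∀ {G} (c : V G → Fin 2) → ¬ HasRainbow3AP G c
three-colours-needed c (u , v , w , u≢v , v≢w , u≢w , _) = pigeonhole (c u) (c v) (c w) u≢v v≢w u≢w
  where
  pigeonhole : (a b d : Fin 2) → a ≢ b → b ≢ d → a ≢ d → ⊥
  pigeonhole zero       zero       _          a≢b _   _   = a≢b refl
  pigeonhole (suc zero) (suc zero) _          a≢b _   _   = a≢b refl
  pigeonhole zero       (suc zero) zero       _   _   a≢d = a≢d refl
  pigeonhole zero       (suc zero) (suc zero) _   b≢d _   = b≢d refl
  pigeonhole (suc zero) zero       zero       _   b≢d _   = b≢d refl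
  pigeonhole (suc zero) zero       (suc zero) _   _   a≢d = a≢d refl

2k+1≡1+k+k : ∀ k → 2 * k + 1 ≡ suc (k + k)
2k+1≡1+k+k k = trans (+-comm (2 * k) 1) (cong (λ l → suc (k + l)) (+-identityʳ k))

lemma6 : ∀ (m k : ℕ) → 2 ≤ m → 1 ≤ k → AwIs (P m □ C (2 * k + 1)) 3
lemma6 (suc (suc m′)) (suc k′) (s≤s (s≤s z≤n)) (s≤s z≤n) = s≤s z≤n , every-colouring , no-colouring
  where
  n = 2 * suc k′ + 1
  G = P (suc (suc m′)) □ C n

  every-colouring : AllRainbow G 3
  every-colouring = subst (λ l → AllRainbow (P (suc (suc m′)) □ C l) 3) (sym (2k+1≡1+k+k (suc k′)))
                      (λ c → PathOddCycle.Colouring.surjective⇒rainbow m′ k′ c)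

  by-row : V G → Fin 2
  by-row (zero  , _) = zero
  by-row (suc _ , _) = suc zero

  by-row-surjective : Surj by-row
  by-row-surjective zero       = (zero , zero) , refl
  by-row-surjective (suc zero) = (suc zero , zero) , refl

  no-colouring : ∀ s → 1 ≤ s → s < 3 → ¬ AllRainbow G s
  no-colouring 1 _ _ all with all (λ _ → zero) (λ { zero → (zero , zero) , refl })
  ... | _ , _ , _ , 0≢0 , _ = 0≢0 refl
  no-colouring 2 _ _ all = three-colours-needed by-row (all by-row by-row-surjective)
  no-colouring (suc (suc (suc _))) _ (s≤s (s≤s (s≤s ())))
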